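{- Let $C\subseteq\mathbb{R}^{(\mathbb{N})}$ be a $\mathrm{Sym}$-invariant cone with $C=\mathrm{cone}(\mathrm{Sym}(G_r))$ for some subset $G_r\subseteq\mathbb{R}^r$, $r\ge1$. Let $C_{2r}=\mathrm{cone}(\mathrm{Sym}(2r)(G_r))\subseteq\mathbb{R}^{2r}$ and $C_{2r}^*=\{v\in\mathbb{R}^{2r}\mid\langle u,v\rangle\ge0\ \forall u\in C_{2r}\}$. Then the set $$F=\{(u,w)\mid u=(u_1,\dots,u_{2r})\in\mathbb{O}(C_{2r}^*),\ w\in\mathbb{O}([u_r,u_{r+1}]^{\mathbb{N}})\}$$ is contained in $C^*=\{v\in\mathbb{R}^{\mathbb{N}}\mid\langle x,v\rangle\ge0\ \forall x\in C\}$.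
   Context: $\mathbb{R}^{(\mathbb{N})}$ is the space of real sequences with finitely many nonzero entries, $\mathbb{R}^n$ identified with those vanishing after index $n$; $\mathbb{R}^{\mathbb{N}}$ is the space of all real sequences, with $\langle x,v\rangle=\sum_ix_iv_i$. $\mathrm{Sym}$ (resp. $\mathrm{Sym}(n)$) is the group of permutations of $\mathbb{N}$ fixing all but finitely many elements (resp. of $[n]$), acting by permuting coordinates; $\mathrm{cone}(A)$ is the set of finite nonnegative combinations of elements of $A$. $\mathbb{O}(\mathbb{R}^n)$ is the set of non-decreasing vectors $(u_1\le\dots\le u_n)$ and $\mathbb{O}(D)=D\cap\mathbb{O}(\mathbb{R}^n)$. $\mathbb{O}([a,b]^{\mathbb{N}})$ denotes the set of non-decreasing sequences $(w_1,w_2,\dots)$ with all $w_i\in[a,b]$. For $u\in\mathbb{R}^{2r}$ and $w=(w_1,w_2,\dots)\in\mathbb{R}^{\mathbb{N}}$, $(u,w)=(u_1,\dots,u_{2r},w_1,w_2,\dots)\in\mathbb{R}^{\mathbb{N}}$. -}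

module Defs where

open import Data.Nat using (ℕ; zero; suc; _<?_) renaming (_≤_ to _≤ℕ_; _+_ to _+ℕ_; _∸_ to _∸ℕ_)
open import Data.Fin using (Fin; toℕ; fromℕ<)
open import Data.Fin.Permutation using (Permutation′; _⟨$⟩ˡ_)
open import Data.Product using (Σ; ∃; _×_; proj₁)
open import Data.List using (List; []; _∷_)
open import Data.Empty using (⊥)
open import Data.Sum using () renaming (_⊎_ to _⊎'_)
import Data.Fin as Fin
import Data.List
open import Relation.Nullary using (¬_; yes; no)
open import Relation.Binary.PropositionalEquality using (_≡_)

-- The real numbers, axiomatised as a complete ordered field
-- (any model is, classically, isomorphic to ℝ).

record RealField : Set₁ where
  infixl 6 _+_
  infixl 7 _*_
  infix 4 _≤_
  field
    Carrier : Set
    0# 1#   : Carrier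
    _+_ _*_ : Carrier → Carrier → Carrier
    -_      : Carrier → Carrier
    _≤_     : Carrier → Carrier → Set
    +-assoc     : ∀ x y z → (x + y) + z ≡ x + (y + z)
    +-comm      : ∀ x y → x + y ≡ y + x
    +-identityˡ : ∀ x → 0# + x ≡ x
    +-inverseˡ  : ∀ x → (- x) + x ≡ 0#
    *-assoc     : ∀ x y z → (x * y) * z ≡ x * (y * z)
    *-comm      : ∀ x y → x * y ≡ y * x
    *-identityˡ : ∀ x → 1# * x ≡ x
    distribˡ    : ∀ x y z → x * (y + z) ≡ (x * y) + (x * z)
    0≢1         : ¬ (0# ≡ 1#)
    *-inverse   : ∀ x → ¬ (x ≡ 0#) → ∃ λ y → y * x ≡ 1#
    ≤-refl      : ∀ x → x ≤ x
    ≤-trans     : ∀ {x y z} → x ≤ y → y ≤ z → x ≤ z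
    ≤-antisym   : ∀ {x y} → x ≤ y → y ≤ x → x ≡ y
    ≤-total     : ∀ x y → (x ≤ y) ⊎' (y ≤ x)
    +-mono-≤    : ∀ {x y} z → x ≤ y → x + z ≤ y + z
    *-nonneg    : ∀ {x y} → 0# ≤ x → 0# ≤ y → 0# ≤ x * y
    sup : (P : Carrier → Set) → ∃ P → (∃ λ b → ∀ x → P x → x ≤ b) →
          ∃ λ s → (∀ x → P x → x ≤ s) × (∀ b → (∀ x → P x → x ≤ b) → s ≤ b)

module Cones (ℝ : RealField) where
  open RealField ℝ renaming (Carrier to R)

  sumFin : ∀ {m} → (Fin m → R) → R
  sumFin {zero}  f = 0#
  sumFin {suc m} f = f Fin.zero + sumFin (λ i → f (Fin.suc i))

  sumℕ : ℕ → (ℕ → R) → R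
  sumℕ zero    f = 0#
  sumℕ (suc n) f = sumℕ n f + f n

  sumList : List R → R
  sumList []       = 0#
  sumList (x ∷ xs) = x + sumList xs

  -- a vector of ℝ^m read as a sequence (0 outside the first m entries),
  -- i.e. the identification ℝ^m ⊆ ℝ^(ℕ)
  lookupℕ : ∀ {m} → (Fin m → R) → ℕ → R
  lookupℕ {m} y i with i <? m
  ... | yes i<m = y (fromℕ< i<m)
  ... | no  _   = 0#

  pad : ∀ {r} m → (Fin r → R) → Fin m → R
  pad m g i = lookupℕ g (toℕ i)

  act : ∀ {m} → Permutation′ m → (Fin m → R) → Fin m → R
  act σ y i = y (σ ⟨$⟩ˡ i)

  record Term (r m : ℕ) (G : (Fin r → R) → Set) : Set where
    field
      coeff  : R
      coeff≥0 : 0# ≤ coeff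
      perm   : Permutation′ m
      gen    : Fin r → R
      gen∈G  : G gen

  termVal : ∀ {r m G} → Term r m G → Fin m → R
  termVal {m = m} t i = Term.coeff t * act (Term.perm t) (pad m (Term.gen t)) i

  InConeSym : ∀ r m → ((Fin r → R) → Set) → (Fin m → R) → Set
  InConeSym r m G y =
    Σ (List (Term r m G)) λ ts →
      ∀ i → y i ≡ sumList (Data.List.map (λ t → termVal t i) ts)

  -- x ∈ C = cone(Sym(G)) ⊆ ℝ^(ℕ); every element of cone(Sym(G)) only
  -- involves finitely many permutations, all of which lie in some Sym(m)
  InC : ∀ r → ((Fin r → R) → Set) → (ℕ → R) → Set
  InC r G x = Σ ℕ λ m → r ≤ℕ m × Σ (Fin m → R) λ y →
                InConeSym r m G y × (∀ i → x i ≡ lookupℕ y i)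

  -- C* ⊆ ℝ^ℕ ; ⟨x,v⟩ = Σ_{i<n} x_i v_i for any n past the support of x
  InCdual : ∀ r → ((Fin r → R) → Set) → (ℕ → R) → Set
  InCdual r G v = ∀ (x : ℕ → R) (n : ℕ) → InC r G x →
                  (∀ i → n ≤ℕ i → x i ≡ 0#) →
                  0# ≤ sumℕ n (λ i → x i * v i)

  InC2rDual : ∀ r → ((Fin r → R) → Set) → (Fin (r +ℕ r) → R) → Set
  InC2rDual r G u = ∀ (y : Fin (r +ℕ r) → R) → InConeSym r (r +ℕ r) G y →
                    0# ≤ sumFin (λ i → y i * u i)

  NondecrVec : ∀ {n} → (Fin n → R) → Set
  NondecrVec {n} u = ∀ (i j : Fin n) → toℕ i ≤ℕ toℕ j → u i ≤ u j

  NondecrSeq : (ℕ → R) → Set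
  NondecrSeq w = ∀ i j → i ≤ℕ j → w i ≤ w j

  join : ∀ r → (Fin (r +ℕ r) → R) → (ℕ → R) → ℕ → R
  join r u w i with i <? r +ℕ r
  ... | yes i<2r = u (fromℕ< i<2r)
  ... | no  _    = w (i ∸ℕ (r +ℕ r))

-- Every x ∈ C is a nonnegative combination of vectors σ g (g ∈ G, σ a finite permutation),
-- so it suffices that ⟨σ g, v⟩ = Σₖ gₖ v_{σ k} ≥ 0 for v = (u, w). Every entry of w lies
-- between u_r and u_{r+1}, while v ≤ u_r on the first r slots and v ≥ u_{r+1} on the next r.
-- Hence a position σ k ≥ 2r can be moved, without increasing the pairing, to a free slot
-- among the first r if gₖ ≥ 0 and among the next r if gₖ ≤ 0; free slots exist by
-- pigeonhole, as g has only r entries. Once all positions lie below 2r the pairing is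
-- ⟨τ g, u⟩ for some τ ∈ Sym(2r), which is nonnegative because u ∈ C_{2r}^*.

module Submission where

open import Defs
open import Data.Nat using (ℕ; zero; suc; z≤n; s≤s; _<?_; _∸_) renaming (_≤_ to _≤ℕ_; _<_ to _<ℕ_; _+_ to _+ℕ_)
import Data.Nat.Properties as ℕ
open import Data.Fin using (Fin; toℕ; fromℕ<; fromℕ; inject≤; inject₁; punchOut)
import Data.Fin.Properties as Fin
open import Data.Fin.Permutation using (Permutation′; _⟨$⟩ʳ_; _⟨$⟩ˡ_; _∘ₚ_)
import Data.Fin.Permutation as Perm
import Data.Fin.Permutation.Components as PC
open import Data.Product using (∃; ∃₂; _×_; _,_; proj₁; proj₂)
open import Data.Sum using (_⊎_; inj₁; inj₂)
open import Data.List using ([]; _∷_; map)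
open import Data.Vec.Functional using (updateAt)
open import Data.Vec.Functional.Properties using (updateAt-updates; updateAt-minimal)
open import Function using (_∘_; const)
open import Function.Bundles using (Injection)
open import Function.Definitions using (Injective)
open import Function.Properties.Inverse using (↔⇒↣)
open import Algebra.Bundles using (CommutativeRing)
open import Algebra.Consequences.Propositional using (comm∧idˡ⇒id; comm∧invˡ⇒inv; comm∧distrˡ⇒distrʳ)
open import Relation.Binary.Bundles using (Preorder)
import Relation.Binary.Reasoning.Preorder
open import Relation.Binary.Reasoning.Syntax using (module ≤-syntax)
open import Relation.Nullary using (Dec; yes; no; ¬_; contradiction)
open import Relation.Nullary.Decidable using (dec-true; dec-false)
open import Relation.Binary.PropositionalEquality

module RealFieldProperties (ℝ : RealField) where
  open RealField ℝ renaming (Carrier to R)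

  commutativeRing : CommutativeRing _ _
  commutativeRing = record
    { isCommutativeRing = record
      { isRing = record
        { +-isAbelianGroup = record
          { isGroup = record
            { isMonoid = record
              { isSemigroup = record
                { isMagma = record { isEquivalence = isEquivalence ; ∙-cong = cong₂ _+_ }
                ; assoc = +-assoc }
              ; identity = comm∧idˡ⇒id +-comm +-identityˡ }
            ; inverse = comm∧invˡ⇒inv +-comm +-inverseˡ
            ; ⁻¹-cong = cong -_ }
          ; comm = +-comm }
        ; *-cong = cong₂ _*_
        ; *-assoc = *-assoc
        ; *-identity = comm∧idˡ⇒id *-comm *-identityˡ
        ; distrib = distribˡ , comm∧distrˡ⇒distrʳ *-comm distribˡ }
      ; *-comm = *-comm } }

  open CommutativeRing commutativeRing using (ring; semiring; -‿inverseʳ)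
  open CommutativeRing commutativeRing public using (+-identityʳ; zeroˡ; distribʳ)
  open import Algebra.Properties.Ring ring using (-1*x≈-x; -‿distribˡ-*; x[y-z]≈xy-xz)
  open import Algebra.Properties.AbelianGroup (CommutativeRing.+-abelianGroup commutativeRing)
    using (⁻¹-involutive)
  open import Algebra.Properties.Semiring.Sum semiring using (sum-replicate-zero)
  open import Algebra.Properties.Semiring.Sum semiring public
    using (sum; sum-cong-≗; sum-init-last; ∑-permute; ∑-distrib-+; *-distribˡ-sum)

  infixl 6 _-_
  _-_ : R → R → R
  x - y = x + - y

  +-monoʳ-≤ : ∀ {x y} z → x ≤ y → z + x ≤ z + y
  +-monoʳ-≤ {x} {y} z x≤y = subst₂ _≤_ (+-comm x z) (+-comm y z) (+-mono-≤ z x≤y)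

  +-mono₂-≤ : ∀ {x y z t} → x ≤ y → z ≤ t → x + z ≤ y + t
  +-mono₂-≤ {y = y} {z} x≤y z≤t = ≤-trans (+-mono-≤ z x≤y) (+-monoʳ-≤ y z≤t)

  x≤y⇒0≤y-x : ∀ {x y} → x ≤ y → 0# ≤ y - x
  x≤y⇒0≤y-x {x} x≤y = subst (_≤ _) (-‿inverseʳ x) (+-mono-≤ (- x) x≤y)

  0≤y-x⇒x≤y : ∀ {x y} → 0# ≤ y - x → x ≤ y
  0≤y-x⇒x≤y {x} {y} 0≤y-x = subst₂ _≤_ (+-identityˡ x) y-x+x≡y (+-mono-≤ x 0≤y-x)
    where
    y-x+x≡y : y - x + x ≡ y
    y-x+x≡y = trans (+-assoc y (- x) x) (trans (cong (y +_) (+-inverseˡ x)) (+-identityʳ y))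

  *-monoˡ-≤-nonneg : ∀ {g x y} → 0# ≤ g → x ≤ y → g * x ≤ g * y
  *-monoˡ-≤-nonneg {g} {x} {y} 0≤g x≤y =
    0≤y-x⇒x≤y (subst (0# ≤_) (x[y-z]≈xy-xz g y x) (*-nonneg 0≤g (x≤y⇒0≤y-x x≤y)))

  *-monoˡ-≤-nonpos : ∀ {g x y} → g ≤ 0# → x ≤ y → g * y ≤ g * x
  *-monoˡ-≤-nonpos {g} {x} {y} g≤0 x≤y =
    0≤y-x⇒x≤y (subst (0# ≤_) -g*y--g*x≡g*x-g*y (x≤y⇒0≤y-x (*-monoˡ-≤-nonneg 0≤-g x≤y)))
    where
    0≤-g : 0# ≤ - g
    0≤-g = subst (0# ≤_) (+-identityˡ (- g)) (x≤y⇒0≤y-x g≤0)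
    -g*y--g*x≡g*x-g*y : - g * y - - g * x ≡ g * x - g * y
    -g*y--g*x≡g*x-g*y = begin
      - g * y - - g * x       ≡⟨ cong₂ _-_ (sym (-‿distribˡ-* g y)) (sym (-‿distribˡ-* g x)) ⟩
      - (g * y) - - (g * x)   ≡⟨ cong (- (g * y) +_) (⁻¹-involutive (g * x)) ⟩
      - (g * y) + g * x       ≡⟨ +-comm (- (g * y)) (g * x) ⟩
      g * x - g * y           ∎
      where open ≡-Reasoning

  0≤1 : 0# ≤ 1#
  0≤1 with ≤-total 0# 1#
  ... | inj₁ 0≤1 = 0≤1
  ... | inj₂ 1≤0 = subst (0# ≤_) -1*-1≡1 (*-nonneg 0≤-1 0≤-1)
    where
    0≤-1 : 0# ≤ - 1#
    0≤-1 = subst (0# ≤_) (+-identityˡ (- 1#)) (x≤y⇒0≤y-x 1≤0)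
    -1*-1≡1 : - 1# * - 1# ≡ 1#
    -1*-1≡1 = trans (-1*x≈-x (- 1#)) (⁻¹-involutive 1#)

  sum-mono-≤ : ∀ {n} {f g : Fin n → R} → (∀ i → f i ≤ g i) → sum f ≤ sum g
  sum-mono-≤ {zero}  _   = ≤-refl 0#
  sum-mono-≤ {suc n} f≤g = +-mono₂-≤ (f≤g Fin.zero) (sum-mono-≤ (f≤g ∘ Fin.suc))

  sum-zeros : ∀ {n} {f : Fin n → R} → (∀ i → f i ≡ 0#) → sum f ≡ 0#
  sum-zeros {n} zeros = trans (sum-cong-≗ zeros) (sum-replicate-zero n)

  ≤-preorder : Preorder _ _ _
  ≤-preorder = record
    { Carrier = R ; _≈_ = _≡_ ; _≲_ = _≤_
    ; isPreorder = record { isEquivalence = isEquivalence ; reflexive = λ { refl → ≤-refl _ } ; trans = ≤-trans } }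

  module ≤-Reasoning where
    open Relation.Binary.Reasoning.Preorder ≤-preorder public
    open ≤-syntax _IsRelatedTo_ _IsRelatedTo_ ≲-go public

transpose-matchˡ : ∀ {n} (i j : Fin n) → PC.transpose i j i ≡ j
transpose-matchˡ i j rewrite dec-true (i Fin.≟ i) refl = refl

transpose-fix : ∀ {n} {i j k : Fin n} → k ≢ i → k ≢ j → PC.transpose i j k ≡ k
transpose-fix {i = i} {j} {k} k≢i k≢j rewrite dec-false (k Fin.≟ i) k≢i | dec-false (k Fin.≟ j) k≢j = refl

extendToPermutation : ∀ {r n} (e q : Fin r → Fin n) →
                      Injective _≡_ _≡_ e → Injective _≡_ _≡_ q →
                      ∃ λ (τ : Permutation′ n) → ∀ k → τ ⟨$⟩ʳ e k ≡ q k
extendToPermutation {zero}  e q _     _     = Perm.id , λ ()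
extendToPermutation {suc r} e q e-inj q-inj = τ ∘ₚ Perm.transpose (τ ⟨$⟩ʳ e Fin.zero) (q Fin.zero) , extends
  where
  IH = extendToPermutation (e ∘ Fin.suc) (q ∘ Fin.suc) (Fin.suc-injective ∘ e-inj) (Fin.suc-injective ∘ q-inj)
  τ = proj₁ IH
  extends : ∀ k → PC.transpose (τ ⟨$⟩ʳ e Fin.zero) (q Fin.zero) (τ ⟨$⟩ʳ e k) ≡ q k
  extends Fin.zero    = transpose-matchˡ (τ ⟨$⟩ʳ e Fin.zero) (q Fin.zero)
  extends (Fin.suc k) = trans (cong (PC.transpose _ _) (proj₂ IH k))
    (transpose-fix (λ eq → Fin.0≢1+n (sym (e-inj (Injection.injective (↔⇒↣ τ) (trans (proj₂ IH k) eq)))))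
                   (λ eq → Fin.0≢1+n (sym (q-inj eq))))

missed-in-window : ∀ {n} (p : Fin n → ℕ) (k : Fin n) a → a +ℕ n ≤ℕ p k →
                   ∃ λ s → a ≤ℕ s × s <ℕ a +ℕ n × (∀ i → p i ≢ s)
missed-in-window {suc n} p k a a+n≤pk = from-decision (Fin.all? hit?)
  where
  Hit : Fin (suc n) → Set
  Hit t = ∃ λ i → p i ≡ a +ℕ toℕ t
  hit? : ∀ t → Dec (Hit t)
  hit? t = Fin.any? (λ i → p i ℕ.≟ a +ℕ toℕ t)
  window-overfull : ¬ (∀ t → Hit t)
  window-overfull all = no-collision (Fin.pigeonhole (ℕ.n<1+n n) (λ t → punchOut (k≢preimage t)))
    where
    k≢preimage : ∀ t → k ≢ proj₁ (all t)
    k≢preimage t k≡ = ℕ.<⇒≱ (ℕ.+-monoʳ-< a (Fin.toℕ<n t))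
                         (subst (a +ℕ suc n ≤ℕ_) (trans (cong p k≡) (proj₂ (all t))) a+n≤pk)
    no-collision : ¬ (∃₂ λ i j → toℕ i <ℕ toℕ j × punchOut (k≢preimage i) ≡ punchOut (k≢preimage j))
    no-collision (i , j , i<j , same) = ℕ.<⇒≢ i<j (ℕ.+-cancelˡ-≡ a _ _ (begin
      a +ℕ toℕ i        ≡⟨ sym (proj₂ (all i)) ⟩
      p (proj₁ (all i)) ≡⟨ cong p (Fin.punchOut-injective (k≢preimage i) (k≢preimage j) same) ⟩
      p (proj₁ (all j)) ≡⟨ proj₂ (all j) ⟩
      a +ℕ toℕ j        ∎))
      where open ≡-Reasoning
  from-decision : Dec (∀ t → Hit t) → ∃ λ s → a ≤ℕ s × s <ℕ a +ℕ suc n × (∀ i → p i ≢ s)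
  from-decision (yes all) = contradiction all window-overfull
  from-decision (no ¬all) =
    let t , ¬hit = Fin.¬∀⟶∃¬ _ Hit hit? ¬all
    in a +ℕ toℕ t , ℕ.m≤m+n a (toℕ t) , ℕ.+-monoʳ-< a (Fin.toℕ<n t) , λ i pi≡s → ¬hit (i , pi≡s)

updateAt-injective : ∀ {n} {A : Set} {p : Fin n → A} (k : Fin n) {s} →
                     Injective _≡_ _≡_ p → (∀ i → p i ≢ s) → Injective _≡_ _≡_ (updateAt p k (const s))
updateAt-injective {p = p} k {s} p-inj fresh {i} {j} eq with i Fin.≟ k | j Fin.≟ k
... | yes refl | yes refl = refl
... | yes refl | no j≢k   = contradiction (trans (sym (updateAt-minimal j k p j≢k)) (trans (sym eq) (updateAt-updates k p))) (fresh j)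
... | no i≢k   | yes refl = contradiction (trans (sym (updateAt-minimal i k p i≢k)) (trans eq (updateAt-updates k p))) (fresh i)
... | no i≢k   | no j≢k   = p-inj (trans (sym (updateAt-minimal i k p i≢k)) (trans eq (updateAt-minimal j k p j≢k)))

module ConeDuality (ℝ : RealField) where
  open RealField ℝ renaming (Carrier to R)
  open RealFieldProperties ℝ
  open Cones ℝ

  sumFin≡sum : ∀ {m} (f : Fin m → R) → sumFin f ≡ sum f
  sumFin≡sum {zero}  f = refl
  sumFin≡sum {suc m} f = cong (f Fin.zero +_) (sumFin≡sum (f ∘ Fin.suc))

  sumℕ≡sum : ∀ m (f : ℕ → R) → sumℕ m f ≡ sum (λ (j : Fin m) → f (toℕ j))
  sumℕ≡sum zero    f = refl
  sumℕ≡sum (suc m) f = begin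
    sumℕ m f + f m                                                  ≡⟨ cong₂ _+_ (sumℕ≡sum m f) (cong f (sym (Fin.toℕ-fromℕ m))) ⟩
    sum (λ (j : Fin m) → f (toℕ j)) + f (toℕ (fromℕ m))             ≡⟨ cong (_+ _) (sum-cong-≗ {m} (λ j → cong f (sym (Fin.toℕ-inject₁ j)))) ⟩
    sum (λ (j : Fin m) → f (toℕ (inject₁ j))) + f (toℕ (fromℕ m))   ≡⟨ sym (sum-init-last (λ j → f (toℕ j))) ⟩
    sum (λ (j : Fin (suc m)) → f (toℕ j))                           ∎
    where open ≡-Reasoning

  sumℕ-zeros-beyond : ∀ n k (f : ℕ → R) → (∀ i → n ≤ℕ i → f i ≡ 0#) → sumℕ (k +ℕ n) f ≡ sumℕ n f
  sumℕ-zeros-beyond n zero    f _     = refl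
  sumℕ-zeros-beyond n (suc k) f zeros =
    trans (cong₂ _+_ (sumℕ-zeros-beyond n k f zeros) (zeros (k +ℕ n) (ℕ.m≤n+m n k))) (+-identityʳ _)

  sumList-nonneg : ∀ {A : Set} (f : A → R) → (∀ a → 0# ≤ f a) → ∀ xs → 0# ≤ sumList (map f xs)
  sumList-nonneg f _        []       = ≤-refl 0#
  sumList-nonneg f f-nonneg (x ∷ xs) =
    subst (_≤ sumList (map f (x ∷ xs))) (+-identityˡ 0#) (+-mono₂-≤ (f-nonneg x) (sumList-nonneg f f-nonneg xs))

  sumList-*ʳ : ∀ {A : Set} (f : A → R) c xs → sumList (map f xs) * c ≡ sumList (map (λ a → f a * c) xs)
  sumList-*ʳ f c []       = zeroˡ c
  sumList-*ʳ f c (x ∷ xs) = trans (distribʳ c (f x) _) (cong (f x * c +_) (sumList-*ʳ f c xs))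

  ∑-sumList-comm : ∀ {n} {A : Set} (T : A → Fin n → R) xs →
                   sum (λ j → sumList (map (λ t → T t j) xs)) ≡ sumList (map (λ t → sum (T t)) xs)
  ∑-sumList-comm {n} T []       = sum-zeros {n} (λ _ → refl)
  ∑-sumList-comm T (x ∷ xs) = trans (∑-distrib-+ (T x) _) (cong (sum (T x) +_) (∑-sumList-comm T xs))

  lookupℕ-fromℕ< : ∀ {m} (y : Fin m → R) {i} (i<m : i <ℕ m) → lookupℕ y i ≡ y (fromℕ< i<m)
  lookupℕ-fromℕ< {m} y {i} i<m with i <? m
  ... | yes _   = refl
  ... | no  i≮m = contradiction i<m i≮m

  lookupℕ-toℕ : ∀ {m} (y : Fin m → R) j → lookupℕ y (toℕ j) ≡ y j
  lookupℕ-toℕ y j = trans (lookupℕ-fromℕ< y (Fin.toℕ<n j)) (cong y (Fin.fromℕ<-toℕ j _))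

  lookupℕ-≥ : ∀ {m} (y : Fin m → R) {i} → m ≤ℕ i → lookupℕ y i ≡ 0#
  lookupℕ-≥ {m} y {i} m≤i with i <? m
  ... | yes i<m = contradiction m≤i (ℕ.<⇒≱ i<m)
  ... | no  _   = refl

  lookupℕ-suc : ∀ {m} (y : Fin (suc m) → R) i → lookupℕ y (suc i) ≡ lookupℕ (y ∘ Fin.suc) i
  lookupℕ-suc {m} y i with ℕ.<-≤-connex i m
  ... | inj₁ i<m = trans (lookupℕ-fromℕ< y (s≤s i<m)) (sym (lookupℕ-fromℕ< (y ∘ Fin.suc) i<m))
  ... | inj₂ m≤i = trans (lookupℕ-≥ y (s≤s m≤i)) (sym (lookupℕ-≥ (y ∘ Fin.suc) m≤i))

  ∑-pad-* : ∀ {r m} (r≤m : r ≤ℕ m) (g : Fin r → R) (h : Fin m → R) →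
            sum (λ i → pad m g i * h i) ≡ sum (λ k → g k * h (inject≤ k r≤m))
  ∑-pad-* {zero} {m} r≤m   g h = sum-zeros {m} (λ i → trans (cong (_* h i) (lookupℕ-≥ g {toℕ i} z≤n)) (zeroˡ (h i)))
  ∑-pad-* {suc r} (s≤s r≤m) g h = cong (g Fin.zero * h Fin.zero +_) (begin
    sum (λ i → lookupℕ g (suc (toℕ i)) * h (Fin.suc i))           ≡⟨ sum-cong-≗ (λ i → cong (_* h (Fin.suc i)) (lookupℕ-suc g (toℕ i))) ⟩
    sum (λ i → pad _ (g ∘ Fin.suc) i * h (Fin.suc i))             ≡⟨ ∑-pad-* r≤m (g ∘ Fin.suc) (h ∘ Fin.suc) ⟩
    sum (λ k → g (Fin.suc k) * h (Fin.suc (inject≤ k r≤m)))       ∎)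
    where open ≡-Reasoning

  ∑-act-pad-* : ∀ {r m} (r≤m : r ≤ℕ m) (σ : Permutation′ m) (g : Fin r → R) (h : Fin m → R) →
                sum (λ i → act σ (pad m g) i * h i) ≡ sum (λ k → g k * h (σ ⟨$⟩ʳ inject≤ k r≤m))
  ∑-act-pad-* {m = m} r≤m σ g h = begin
    sum (λ i → pad m g (σ ⟨$⟩ˡ i) * h i)                          ≡⟨ ∑-permute _ σ ⟩
    sum (λ i → pad m g (σ ⟨$⟩ˡ (σ ⟨$⟩ʳ i)) * h (σ ⟨$⟩ʳ i))          ≡⟨ sum-cong-≗ (λ i → cong (λ j → pad m g j * h (σ ⟨$⟩ʳ i)) (Perm.inverseˡ σ)) ⟩
    sum (λ i → pad m g i * h (σ ⟨$⟩ʳ i))                          ≡⟨ ∑-pad-* r≤m g (λ i → h (σ ⟨$⟩ʳ i)) ⟩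
    sum (λ k → g k * h (σ ⟨$⟩ʳ inject≤ k r≤m))                     ∎
    where open ≡-Reasoning

  sumℕ-pairing≡sum : ∀ {m} n (y : Fin m → R) (x v : ℕ → R) → (∀ i → x i ≡ lookupℕ y i) →
                     (∀ i → n ≤ℕ i → x i ≡ 0#) → sumℕ n (λ i → x i * v i) ≡ sum (λ j → y j * v (toℕ j))
  sumℕ-pairing≡sum {m} n y x v x≡y x-beyond-n = begin
    sumℕ n xv                      ≡⟨ sym (sumℕ-zeros-beyond n m xv (λ i n≤i → trans (cong (_* v i) (x-beyond-n i n≤i)) (zeroˡ (v i)))) ⟩
    sumℕ (m +ℕ n) xv               ≡⟨ cong (λ k → sumℕ k xv) (ℕ.+-comm m n) ⟩
    sumℕ (n +ℕ m) xv               ≡⟨ sumℕ-zeros-beyond m n xv (λ i m≤i → trans (cong (_* v i) (trans (x≡y i) (lookupℕ-≥ y m≤i))) (zeroˡ (v i))) ⟩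
    sumℕ m xv                      ≡⟨ sumℕ≡sum m xv ⟩
    sum (λ (j : Fin m) → xv (toℕ j)) ≡⟨ sum-cong-≗ {m} (λ j → cong (_* v (toℕ j)) (trans (x≡y (toℕ j)) (lookupℕ-toℕ y j))) ⟩
    sum (λ j → y j * v (toℕ j))    ∎
    where
    open ≡-Reasoning
    xv = λ i → x i * v i

  -- ⟨σ g, v⟩ for a permutation σ sending k to p k
  pairAt : ∀ {r} → (Fin r → R) → (Fin r → ℕ) → (ℕ → R) → R
  pairAt g p v = sum (λ k → g k * v (p k))

  InCdual-fromPlacements : ∀ r (G : (Fin r → R) → Set) (v : ℕ → R) →
                           (∀ g → G g → (p : Fin r → ℕ) → Injective _≡_ _≡_ p → 0# ≤ pairAt g p v) →
                           InCdual r G v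
  InCdual-fromPlacements r G v placements-nonneg x n (m , r≤m , y , (ts , y≡ts) , x≡y) x-beyond-n =
    subst (0# ≤_) (sym ⟨x,v⟩≡) (sumList-nonneg termPairing termPairing-nonneg ts)
    where
    termPairing : Term r m G → R
    termPairing t = sum (λ j → termVal t j * v (toℕ j))

    termPairing-nonneg : ∀ t → 0# ≤ termPairing t
    termPairing-nonneg t = subst (0# ≤_) (sym termPairing≡) (*-nonneg coeff≥0 (placements-nonneg gen gen∈G p p-injective))
      where
      open Term t
      p : Fin r → ℕ
      p k = toℕ (perm ⟨$⟩ʳ inject≤ k r≤m)
      p-injective : Injective _≡_ _≡_ p
      p-injective = Fin.inject≤-injective r≤m r≤m _ _ ∘ Injection.injective (↔⇒↣ perm) ∘ Fin.toℕ-injective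
      termPairing≡ : termPairing t ≡ coeff * pairAt gen p v
      termPairing≡ = begin
        sum (λ j → coeff * act perm (pad m gen) j * v (toℕ j))    ≡⟨ sum-cong-≗ {m} (λ j → *-assoc coeff _ _) ⟩
        sum (λ j → coeff * (act perm (pad m gen) j * v (toℕ j)))  ≡⟨ sym (*-distribˡ-sum {m} coeff _) ⟩
        coeff * sum (λ j → act perm (pad m gen) j * v (toℕ j))    ≡⟨ cong (coeff *_) (∑-act-pad-* r≤m perm gen (v ∘ toℕ)) ⟩
        coeff * pairAt gen p v                                    ∎
        where open ≡-Reasoning

    ⟨x,v⟩≡ : sumℕ n (λ i → x i * v i) ≡ sumList (map termPairing ts)
    ⟨x,v⟩≡ = begin
      sumℕ n (λ i → x i * v i)                                           ≡⟨ sumℕ-pairing≡sum n y x v x≡y x-beyond-n ⟩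
      sum (λ j → y j * v (toℕ j))                                        ≡⟨ sum-cong-≗ (λ j → trans (cong (_* v (toℕ j)) (y≡ts j)) (sumList-*ʳ _ _ ts)) ⟩
      sum (λ j → sumList (map (λ t → termVal t j * v (toℕ j)) ts))      ≡⟨ ∑-sumList-comm (λ t j → termVal t j * v (toℕ j)) ts ⟩
      sumList (map termPairing ts)                                       ∎
      where open ≡-Reasoning

  InC2rDual⇒pairings-nonneg : ∀ r (G : (Fin r → R) → Set) (u : Fin (r +ℕ r) → R) → InC2rDual r G u →
                              ∀ g → G g → (q : Fin r → Fin (r +ℕ r)) → Injective _≡_ _≡_ q →
                              0# ≤ sum (λ k → g k * u (q k))
  InC2rDual⇒pairings-nonneg r G u u-dual g g∈G q q-injective =
    subst (0# ≤_) ⟨τg,u⟩≡ (u-dual (λ i → termVal τg i + 0#) (τg ∷ [] , λ _ → refl))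
    where
    r≤2r = ℕ.m≤m+n r r
    e : Fin r → Fin (r +ℕ r)
    e k = inject≤ k r≤2r
    τ-extends = extendToPermutation e q (Fin.inject≤-injective r≤2r r≤2r _ _) q-injective
    τ = proj₁ τ-extends
    τg : Term r (r +ℕ r) G
    τg = record { coeff = 1# ; coeff≥0 = 0≤1 ; perm = τ ; gen = g ; gen∈G = g∈G }
    ⟨τg,u⟩≡ : sumFin (λ i → (termVal τg i + 0#) * u i) ≡ sum (λ k → g k * u (q k))
    ⟨τg,u⟩≡ = begin
      sumFin (λ i → (termVal τg i + 0#) * u i)        ≡⟨ sumFin≡sum {r +ℕ r} _ ⟩
      sum (λ i → (termVal τg i + 0#) * u i)           ≡⟨ sum-cong-≗ (λ i → cong (_* u i) (trans (+-identityʳ _) (*-identityˡ _))) ⟩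
      sum (λ i → act τ (pad (r +ℕ r) g) i * u i)      ≡⟨ ∑-act-pad-* r≤2r τ g u ⟩
      sum (λ k → g k * u (τ ⟨$⟩ʳ e k))                ≡⟨ sum-cong-≗ (λ k → cong (λ i → g k * u i) (proj₂ τ-extends k)) ⟩
      sum (λ k → g k * u (q k))                       ∎
      where open ≡-Reasoning

  module Relocation (r : ℕ) (v : ℕ → R)
    (prefix≤tail : ∀ {s t} → s <ℕ r → r +ℕ r ≤ℕ t → v s ≤ v t)
    (tail≤suffix : ∀ {s t} → r ≤ℕ s → s <ℕ r +ℕ r → r +ℕ r ≤ℕ t → v t ≤ v s) where

    record Improvement (g : Fin r → R) (p p′ : Fin r → ℕ) : Set where
      field
        injective    : Injective _≡_ _≡_ p′
        keeps-inside : ∀ k → p k <ℕ r +ℕ r → p′ k <ℕ r +ℕ r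
        pairAt-≤     : pairAt g p′ v ≤ pairAt g p v

    open Improvement

    improvement-refl : ∀ {g p} → Injective _≡_ _≡_ p → Improvement g p p
    improvement-refl p-injective = record
      { injective = p-injective ; keeps-inside = λ _ inside → inside ; pairAt-≤ = ≤-refl _ }

    improvement-trans : ∀ {g p p′ p″} → Improvement g p p′ → Improvement g p′ p″ → Improvement g p p″
    improvement-trans p≥p′ p′≥p″ = record
      { injective    = injective p′≥p″
      ; keeps-inside = λ k → keeps-inside p′≥p″ k ∘ keeps-inside p≥p′ k
      ; pairAt-≤     = ≤-trans (pairAt-≤ p′≥p″) (pairAt-≤ p≥p′)
      }

    moveTo : ∀ g p → Injective _≡_ _≡_ p → ∀ k s → s <ℕ r +ℕ r → (∀ i → p i ≢ s) →
             g k * v s ≤ g k * v (p k) → ∃ λ p′ → Improvement g p p′ × p′ k <ℕ r +ℕ r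
    moveTo g p p-injective k s s-inside s-fresh gain =
      p′ , record { injective = updateAt-injective k p-injective s-fresh
                  ; keeps-inside = keeps
                  ; pairAt-≤ = sum-mono-≤ term-≤ }
         , subst (_<ℕ r +ℕ r) (sym (updateAt-updates k p)) s-inside
      where
      p′ = updateAt p k (const s)
      position : ∀ i → (i ≡ k × p′ i ≡ s) ⊎ p′ i ≡ p i
      position i with i Fin.≟ k
      ... | yes refl = inj₁ (refl , updateAt-updates k p)
      ... | no  i≢k  = inj₂ (updateAt-minimal i k p i≢k)
      keeps : ∀ i → p i <ℕ r +ℕ r → p′ i <ℕ r +ℕ r
      keeps i pi-inside with position i
      ... | inj₁ (_ , p′i≡s) = subst (_<ℕ r +ℕ r) (sym p′i≡s) s-inside
      ... | inj₂ p′i≡pi      = subst (_<ℕ r +ℕ r) (sym p′i≡pi) pi-inside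
      term-≤ : ∀ i → g i * v (p′ i) ≤ g i * v (p i)
      term-≤ i with position i
      ... | inj₁ (refl , p′k≡s) = subst (λ j → g k * v j ≤ g k * v (p k)) (sym p′k≡s) gain
      ... | inj₂ p′i≡pi         = subst (λ j → g i * v j ≤ g i * v (p i)) (sym p′i≡pi) (≤-refl _)

    relocate-one : ∀ g p → Injective _≡_ _≡_ p → ∀ k → ∃ λ p′ → Improvement g p p′ × p′ k <ℕ r +ℕ r
    relocate-one g p p-injective k with p k <? r +ℕ r | ≤-total 0# (g k)
    ... | yes inside  | _         = p , improvement-refl p-injective , inside
    ... | no  outside | inj₁ 0≤gk =
      let s , _ , s<r , s-fresh = missed-in-window p k 0 (ℕ.≤-trans (ℕ.m≤m+n r r) (ℕ.≮⇒≥ outside))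
      in moveTo g p p-injective k s (ℕ.<-≤-trans s<r (ℕ.m≤m+n r r)) s-fresh
                (*-monoˡ-≤-nonneg 0≤gk (prefix≤tail s<r (ℕ.≮⇒≥ outside)))
    ... | no  outside | inj₂ gk≤0 =
      let s , r≤s , s<2r , s-fresh = missed-in-window p k r (ℕ.≮⇒≥ outside)
      in moveTo g p p-injective k s s<2r s-fresh
                (*-monoˡ-≤-nonpos gk≤0 (tail≤suffix r≤s s<2r (ℕ.≮⇒≥ outside)))

    relocate-prefix : ∀ g p → Injective _≡_ _≡_ p → ∀ j → j ≤ℕ r →
                      ∃ λ p′ → Improvement g p p′ × (∀ k → toℕ k <ℕ j → p′ k <ℕ r +ℕ r)
    relocate-prefix g p p-injective zero    _   = p , improvement-refl p-injective , λ _ ()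
    relocate-prefix g p p-injective (suc j) j<r with relocate-prefix g p p-injective j (ℕ.<⇒≤ j<r)
    ... | p₁ , p≥p₁ , p₁-inside with relocate-one g p₁ (injective p≥p₁) (fromℕ< j<r)
    ... | p₂ , p₁≥p₂ , p₂j-inside = p₂ , improvement-trans p≥p₁ p₁≥p₂ , p₂-inside
      where
      p₂-inside : ∀ k → toℕ k <ℕ suc j → p₂ k <ℕ r +ℕ r
      p₂-inside k k<1+j with ℕ.m<1+n⇒m<n∨m≡n k<1+j
      ... | inj₁ k<j = keeps-inside p₁≥p₂ k (p₁-inside k k<j)
      ... | inj₂ k≡j = subst (λ i → p₂ i <ℕ r +ℕ r)
                             (sym (Fin.toℕ-injective (trans k≡j (sym (Fin.toℕ-fromℕ< j<r))))) p₂j-inside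

    relocate : ∀ g p → Injective _≡_ _≡_ p →
               ∃ λ (q : Fin r → Fin (r +ℕ r)) → Injective _≡_ _≡_ q × pairAt g (toℕ ∘ q) v ≤ pairAt g p v
    relocate g p p-injective with relocate-prefix g p p-injective r ℕ.≤-refl
    ... | p′ , p≥p′ , inside = q , q-injective , subst (_≤ pairAt g p v) (sym pairAt≡) (pairAt-≤ p≥p′)
      where
      q : Fin r → Fin (r +ℕ r)
      q k = fromℕ< (inside k (Fin.toℕ<n k))
      toℕ∘q≗p′ : ∀ k → toℕ (q k) ≡ p′ k
      toℕ∘q≗p′ k = Fin.toℕ-fromℕ< _
      q-injective : Injective _≡_ _≡_ q
      q-injective {a} {b} qa≡qb =
        injective p≥p′ (trans (sym (toℕ∘q≗p′ a)) (trans (cong toℕ qa≡qb) (toℕ∘q≗p′ b)))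
      pairAt≡ : pairAt g (toℕ ∘ q) v ≡ pairAt g p′ v
      pairAt≡ = sum-cong-≗ (λ k → cong (λ i → g k * v i) (toℕ∘q≗p′ k))

  module _ (r : ℕ) (u : Fin (r +ℕ r) → R) (w : ℕ → R) where

    join-< : ∀ {i} (i<2r : i <ℕ r +ℕ r) → join r u w i ≡ u (fromℕ< i<2r)
    join-< {i} i<2r with i <? r +ℕ r
    ... | yes _   = refl
    ... | no  i≮ = contradiction i<2r i≮

    join-≥ : ∀ {i} → r +ℕ r ≤ℕ i → join r u w i ≡ w (i ∸ (r +ℕ r))
    join-≥ {i} 2r≤i with i <? r +ℕ r
    ... | yes i<2r = contradiction 2r≤i (ℕ.<⇒≱ i<2r)
    ... | no  _    = refl

    join-toℕ : ∀ j → join r u w (toℕ j) ≡ u j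
    join-toℕ j = trans (join-< (Fin.toℕ<n j)) (cong u (Fin.fromℕ<-toℕ j _))

    join-mono-below-2r : NondecrVec u → ∀ {i j} → i ≤ℕ j → (j<2r : j <ℕ r +ℕ r) → join r u w i ≤ join r u w j
    join-mono-below-2r u-mono {i} i≤j j<2r =
      subst₂ _≤_ (sym (join-< i<2r)) (sym (join-< j<2r))
        (u-mono _ _ (subst₂ _≤ℕ_ (sym (Fin.toℕ-fromℕ< i<2r)) (sym (Fin.toℕ-fromℕ< j<2r)) i≤j))
      where i<2r = ℕ.≤-<-trans i≤j j<2r

    join-prefix≤tail : NondecrVec u → (∀ i → lookupℕ u (r ∸ 1) ≤ w i) →
                       ∀ {s t} → s <ℕ r → r +ℕ r ≤ℕ t → join r u w s ≤ join r u w t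
    join-prefix≤tail u-mono u[r-1]≤w {s} {t} (s≤s s≤r-1) 2r≤t = begin
      join r u w s              ≤⟨ join-mono-below-2r u-mono s≤r-1 r-1<2r ⟩
      join r u w (r ∸ 1)        ≡⟨ trans (join-< r-1<2r) (sym (lookupℕ-fromℕ< u r-1<2r)) ⟩
      lookupℕ u (r ∸ 1)         ≤⟨ u[r-1]≤w (t ∸ (r +ℕ r)) ⟩
      w (t ∸ (r +ℕ r))          ≡⟨ sym (join-≥ 2r≤t) ⟩
      join r u w t              ∎
      where
      open ≤-Reasoning
      r-1<2r = ℕ.<-≤-trans (ℕ.n<1+n _) (ℕ.m≤m+n r r)

    join-tail≤suffix : NondecrVec u → (∀ i → w i ≤ lookupℕ u r) →
                       ∀ {s t} → r ≤ℕ s → s <ℕ r +ℕ r → r +ℕ r ≤ℕ t → join r u w t ≤ join r u w s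
    join-tail≤suffix u-mono w≤u[r] {s} {t} r≤s s<2r 2r≤t = begin
      join r u w t              ≡⟨ join-≥ 2r≤t ⟩
      w (t ∸ (r +ℕ r))          ≤⟨ w≤u[r] (t ∸ (r +ℕ r)) ⟩
      lookupℕ u r               ≡⟨ trans (lookupℕ-fromℕ< u r<2r) (sym (join-< r<2r)) ⟩
      join r u w r              ≤⟨ join-mono-below-2r u-mono r≤s s<2r ⟩
      join r u w s              ∎
      where
      open ≤-Reasoning
      r<2r = ℕ.≤-<-trans r≤s s<2r

corollary3p12 : (ℝ : RealField) → let open Cones ℝ in
    (r : ℕ) → 1 ≤ℕ r →
    (G : (Fin r → RealField.Carrier ℝ) → Set) →
    (u : Fin (r +ℕ r) → RealField.Carrier ℝ) → NondecrVec u → InC2rDual r G u →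
    (w : ℕ → RealField.Carrier ℝ) → NondecrSeq w →
    (∀ i → (RealField._≤_ ℝ (lookupℕ u (r ∸ 1)) (w i)) × RealField._≤_ ℝ (w i) (lookupℕ u r)) →
    InCdual r G (join r u w)
corollary3p12 ℝ r _ G u u-mono u-dual w _ w-between =
  InCdual-fromPlacements r G v λ g g∈G p p-injective →
    let q , q-injective , q≤p = relocate g p p-injective
    in ≤-trans (subst (0# ≤_) (pairAt-join g q) (InC2rDual⇒pairings-nonneg r G u u-dual g g∈G q q-injective)) q≤p
  where
  open RealField ℝ
  open Cones ℝ
  open RealFieldProperties ℝ using (sum; sum-cong-≗)
  open ConeDuality ℝ
  v = join r u w
  open Relocation r v (join-prefix≤tail r u w u-mono (proj₁ ∘ w-between)) (join-tail≤suffix r u w u-mono (proj₂ ∘ w-between))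
  pairAt-join : ∀ g (q : Fin r → Fin (r +ℕ r)) → sum (λ k → g k * u (q k)) ≡ pairAt g (toℕ ∘ q) v
  pairAt-join g q = sum-cong-≗ (λ k → cong (g k *_) (sym (join-toℕ r u w (q k))))
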